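{- Let $m\in\mathbb{N}$ and let $\{a_n\}_{n=0}^m$ be a sequence in $\mathfrak{G}$ with $|a_n|>1$ for all $n\ge1$, and let $\{p_n\},\{q_n\}$ be its $\mathcal{Q}$-pair. Suppose $q_n\ne0$ for all $n\ge0$. Let $\sigma\in(\sqrt2,\frac{\sqrt5+1}{2})$ and let $1\le n\le m-1$ be such that $|q_{n-1}|>\sigma|q_{n-2}|$. Then: (i) if $|a_n|>2$ then $|q_n|>\sigma|q_{n-1}|$; (ii) if $|a_n|\le2$ and $\operatorname{Re}(a_na_{n+1})\ge\chi$, where $\chi=2$ if $|a_{n+1}|=\sqrt2$ and $\chi=0$ otherwise, then $|q_{n+1}|>\sigma|q_n|$.
   Context: $\mathfrak{G}$ is the ring of Gaussian integers. The $\mathcal{Q}$-pair of a finite sequence $\{a_n\}_{n=0}^m$ is $\{p_n\}_{n=-1}^m,\{q_n\}_{n=-1}^m$ with $p_{ -1}=1$, $p_0=a_0$, $p_{n+1}=a_{n+1}p_n+p_{n-1}$, $q_{ -1}=0$, $q_0=1$, $q_{n+1}=a_{n+1}q_n+q_{n-1}$.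
   Formalization: The parameter σ ranges over the rationals in $(\sqrt2,\frac{\sqrt5+1}{2})$. -}

module Defs where

open import Data.Nat as ℕ using (ℕ; zero; suc; _≟_)
open import Data.Integer as ℤ using (ℤ; +_)
open import Data.Rational as ℚ using (ℚ; _/_)
open import Relation.Nullary using (yes; no)

infix 5 _+i_
record 𝔾 : Set where
  constructor _+i_
  field
    re : ℤ
    im : ℤ
open 𝔾 public

0𝔾 : 𝔾
0𝔾 = + 0 +i + 0

1𝔾 : 𝔾
1𝔾 = + 1 +i + 0

infixl 6 _⊕_
infixl 7 _⊗_

_⊕_ : 𝔾 → 𝔾 → 𝔾
(a +i b) ⊕ (c +i d) = (a ℤ.+ c) +i (b ℤ.+ d)

_⊗_ : 𝔾 → 𝔾 → 𝔾
(a +i b) ⊗ (c +i d) = (a ℤ.* c ℤ.- b ℤ.* d) +i (a ℤ.* d ℤ.+ b ℤ.* c)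

Re : 𝔾 → ℤ
Re = re

∣_∣² : 𝔾 → ℕ
∣ a +i b ∣² = ℤ.∣ a ℤ.* a ℤ.+ b ℤ.* b ∣

-- 𝒬-pair, shifted by one so that indices start at 0:
--   Qq a k = q_{k-1},  Qp a k = p_{k-1}
Qq : (ℕ → 𝔾) → ℕ → 𝔾
Qq a zero = 0𝔾
Qq a (suc zero) = 1𝔾
Qq a (suc (suc k)) = a (suc k) ⊗ Qq a (suc k) ⊕ Qq a k

Qp : (ℕ → 𝔾) → ℕ → 𝔾
Qp a zero = 1𝔾
Qp a (suc zero) = a 0
Qp a (suc (suc k)) = a (suc k) ⊗ Qp a (suc k) ⊕ Qp a k

q : (ℕ → 𝔾) → ℕ → 𝔾
q a n = Qq a (suc n)

p : (ℕ → 𝔾) → ℕ → 𝔾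
p a n = Qp a (suc n)

toℚ : ℕ → ℚ
toℚ n = + n / 1

-- |x| > σ |y|, for σ ≥ 0; equivalently |x|² > σ² |y|²
AbsGt : ℚ → 𝔾 → 𝔾 → Set
AbsGt σ x y = σ ℚ.* σ ℚ.* toℚ ∣ y ∣² ℚ.< toℚ ∣ x ∣²

χ : 𝔾 → ℤ
χ b with ∣ b ∣² ≟ 2
... | yes _ = + 2
... | no _ = + 0

module Submission where

-- Write σ = P/Q in lowest terms and put r = Q², s = P², so that |u| > σ|v| reads s|v|² < r|u|².
-- The window √2 < σ < φ gives 2r < s, r² + s² ≤ 3rs (that is, σ + 1/σ ≤ √5) and 50s ≤ 131r
-- (that is, σ² < 131/50). With x = q_{n-1}, y = q_{n-2}:
-- (i) if |aₙ|² ≥ 5, the triangle inequality gives |aₙx + y| > (√5 - 1/σ)|x| ≥ σ|x|;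
-- (ii) if 2 ≤ |aₙ|² ≤ 4, then 2|y|² < |x|² and we show |q_{n+1}|² > (131/50)|q_n|². When
-- |a_{n+1}|² ≥ 10 the triangle inequality applied twice even gives |q_{n+1}|² > 3|q_n|². For the
-- finitely many remaining pairs (aₙ, a_{n+1}), q_{n+1} = (aₙa_{n+1} + 1)x + a_{n+1}y turns
-- 50|q_{n+1}|² - 131|q_n|² - 60(|x|² - 2|y|²) into a Hermitian form in (x, y), and a computation
-- checks that it is positive semidefinite; the hypothesis on Re(aₙa_{n+1}) enters only there.

open import Defs
open import Data.Nat as ℕ using (ℕ; suc; zero; z≤n; s≤s; _∸_)
import Data.Nat.Properties as ℕP
open import Data.Integer as ℤ using (ℤ; +_; -[1+_]; +[1+_]; 0ℤ; _+_; _*_; _-_; -_; _≤_; _<_; +≤+; +<+)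
import Data.Integer.Properties as ℤP
open import Data.Integer.Tactic.RingSolver using (solve-∀)
open import Data.Rational as ℚ using (ℚ; 0ℚ; 1ℚ; mkℚ; toℚᵘ)
import Data.Rational.Properties as ℚP
open import Data.Rational.Unnormalised as ℚᵘ using (mkℚᵘ; *<*; _≃_)
import Data.Rational.Unnormalised.Properties as ℚᵘP
open import Data.Nat.Coprimality as Coprimality using (Coprime)
open import Data.List using (List; []; _∷_)
open import Data.List.Relation.Unary.All as All using (All; all?)
open import Data.List.Membership.Propositional using (_∈_)
open import Data.List.Relation.Unary.Any using (here; there)
open import Data.Product using (_×_; _,_)
open import Function.Base using (case_of_)
open import Function.Bundles using (_⇔_; mk⇔; Equivalence)
open import Relation.Nullary using (Dec; yes; no; contradiction)
open import Relation.Nullary.Decidable using (from-yes; map′; _×-dec_; _→-dec_)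
open import Relation.Unary using (Decidable)
open import Relation.Binary.PropositionalEquality

square-nonneg : ∀ i → 0ℤ ≤ i * i
square-nonneg (+ n) = subst (0ℤ ≤_) (ℤP.pos-* n n) (+≤+ z≤n)
square-nonneg -[1+ n ] = +≤+ z≤n

*-nonneg : ∀ {i j} → 0ℤ ≤ i → 0ℤ ≤ j → 0ℤ ≤ i * j
*-nonneg {+ m} {+ n} _ _ = subst (0ℤ ≤_) (ℤP.pos-* m n) (+≤+ z≤n)

*-pos : ∀ {i j} → 0ℤ < i → 0ℤ < j → 0ℤ < i * j
*-pos {+[1+ m ]} {+[1+ n ]} _ _ = +<+ (s≤s z≤n)
*-pos {+ zero} (+<+ ()) _
*-pos {+[1+ m ]} {+ zero} _ (+<+ ())

*-nonneg-cancelˡ : ∀ k {e} → 0ℤ < k → 0ℤ ≤ k * e → 0ℤ ≤ e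
*-nonneg-cancelˡ k {e} 0<k 0≤ke =
  ℤP.*-cancelˡ-≤-pos 0ℤ e k ⦃ ℤ.positive 0<k ⦄ (subst (_≤ k * e) (sym (ℤP.*-zeroʳ k)) 0≤ke)

*-pos-cancelˡ : ∀ k {e} → 0ℤ < k → 0ℤ < k * e → 0ℤ < e
*-pos-cancelˡ k {e} 0<k 0<ke =
  ℤP.*-cancelˡ-<-nonNeg k ⦃ ℤ.nonNegative (ℤP.<⇒≤ 0<k) ⦄ (subst (_< k * e) (sym (ℤP.*-zeroʳ k)) 0<ke)

<⇒0<-diff : ∀ {i j} → i < j → 0ℤ < j - i
<⇒0<-diff {i} {j} i<j = subst (_< j - i) (ℤP.+-inverseʳ i) (ℤP.+-monoˡ-< (- i) i<j)

0<-diff⇒< : ∀ {i j} → 0ℤ < j - i → i < j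
0<-diff⇒< {i} {j} 0<j-i = subst₂ _<_ (ℤP.+-identityʳ i) (i+[j-i]≡j i j) (ℤP.+-monoʳ-< i 0<j-i)
  where
  i+[j-i]≡j : ∀ i j → i + (j - i) ≡ j
  i+[j-i]≡j = solve-∀

≤-byDiff : ∀ {i j} e → j - i ≡ e → 0ℤ ≤ e → i ≤ j
≤-byDiff e j-i≡e 0≤e = ℤP.0≤i-j⇒j≤i (subst (0ℤ ≤_) (sym j-i≡e) 0≤e)

<-byDiff : ∀ {i j} e → j - i ≡ e → 0ℤ < e → i < j
<-byDiff e j-i≡e 0<e = 0<-diff⇒< (subst (0ℤ <_) (sym j-i≡e) 0<e)

<-byScaledDiff : ∀ {i j} k e → 0ℤ < k → k * (j - i) ≡ e → 0ℤ < e → i < j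
<-byScaledDiff k e 0<k k[j-i]≡e 0<e = 0<-diff⇒< (*-pos-cancelˡ k 0<k (subst (0ℤ <_) (sym k[j-i]≡e) 0<e))

norm : 𝔾 → ℤ
norm z = re z * re z + im z * im z

conj : 𝔾 → 𝔾
conj z = re z +i - im z

infixr 8 _·_
_·_ : ℤ → 𝔾 → 𝔾
k · z = k * re z +i k * im z

norm-nonneg : ∀ z → 0ℤ ≤ norm z
norm-nonneg z = ℤP.+-mono-≤ (square-nonneg (re z)) (square-nonneg (im z))

∣∣²≡norm : ∀ z → + ∣ z ∣² ≡ norm z
∣∣²≡norm z = ℤP.0≤i⇒+∣i∣≡i (norm-nonneg z)

≤norm : ∀ {m} z → m ℕ.≤ ∣ z ∣² → + m ≤ norm z
≤norm z m≤∣z∣² = subst (_ ≤_) (∣∣²≡norm z) (+≤+ m≤∣z∣²)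

norm≤ : ∀ {m} z → ∣ z ∣² ℕ.≤ m → norm z ≤ + m
norm≤ z ∣z∣²≤m = subst (_≤ _) (∣∣²≡norm z) (+≤+ ∣z∣²≤m)

norm-⊗ : ∀ u x → norm (u ⊗ x) ≡ norm u * norm x
norm-⊗ u x = components (re u) (im u) (re x) (im x)
  where
  components : ∀ u₁ u₂ x₁ x₂ →
    (u₁ * x₁ - u₂ * x₂) * (u₁ * x₁ - u₂ * x₂) + (u₁ * x₂ + u₂ * x₁) * (u₁ * x₂ + u₂ * x₁)
    ≡ (u₁ * u₁ + u₂ * u₂) * (x₁ * x₁ + x₂ * x₂)
  components = solve-∀

norm-⊕-parallelogram : ∀ u y → norm u ≤ + 2 * norm (u ⊕ y) + + 2 * norm y
norm-⊕-parallelogram u y =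
  ≤-byDiff (norm (u ⊕ (+ 2) · y)) (components (re u) (im u) (re y) (im y)) (norm-nonneg (u ⊕ (+ 2) · y))
  where
  components : ∀ u₁ u₂ y₁ y₂ →
    + 2 * ((u₁ + y₁) * (u₁ + y₁) + (u₂ + y₂) * (u₂ + y₂)) + + 2 * (y₁ * y₁ + y₂ * y₂)
      - (u₁ * u₁ + u₂ * u₂)
    ≡ (u₁ + + 2 * y₁) * (u₁ + + 2 * y₁) + (u₂ + + 2 * y₂) * (u₂ + + 2 * y₂)
  components = solve-∀

-- |u + y|² ≥ (1 - 1/μ)|u|² + (1 - μ)|y|² for μ = 1 + s/r, cleared of denominators.
norm-⊕-lowerBound : ∀ r s u y → r * s * norm u - s * (s + r) * norm y ≤ r * (s + r) * norm (u ⊕ y)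
norm-⊕-lowerBound r s u y =
  ≤-byDiff (norm (r · u ⊕ (s + r) · y)) (components r s (re u) (im u) (re y) (im y))
    (norm-nonneg (r · u ⊕ (s + r) · y))
  where
  components : ∀ r s u₁ u₂ y₁ y₂ →
    r * (s + r) * ((u₁ + y₁) * (u₁ + y₁) + (u₂ + y₂) * (u₂ + y₂))
      - (r * s * (u₁ * u₁ + u₂ * u₂) - s * (s + r) * (y₁ * y₁ + y₂ * y₂))
    ≡ (r * u₁ + (s + r) * y₁) * (r * u₁ + (s + r) * y₁) + (r * u₂ + (s + r) * y₂) * (r * u₂ + (s + r) * y₂)
  components = solve-∀

growth-of-large-a : ∀ r s a x y → 0ℤ < r → 0ℤ < s → r * r + s * s ≤ + 3 * (r * s)
  → s * norm y < r * norm x → + 5 ≤ norm a → s * norm x < r * norm (a ⊗ x ⊕ y)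
growth-of-large-a r s a x y 0<r 0<s window sy<rx 5≤A =
  <-byScaledDiff (s + r) _ (ℤP.+-mono-< 0<s 0<r) (decomposition r s A X Y Q)
    (ℤP.+-mono-<-≤
      (ℤP.+-mono-≤-<
        (ℤP.+-mono-≤ (ℤP.i≤j⇒0≤j-i weighted)
                     (*-nonneg (*-nonneg (ℤP.<⇒≤ (*-pos 0<r 0<s)) (norm-nonneg x)) (ℤP.i≤j⇒0≤j-i 5≤A)))
        (*-pos (ℤP.+-mono-< 0<s 0<r) (<⇒0<-diff sy<rx)))
      (*-nonneg (norm-nonneg x) (ℤP.i≤j⇒0≤j-i window)))
  where
  A = norm a
  X = norm x
  Y = norm y
  Q = norm (a ⊗ x ⊕ y)
  weighted : r * s * (A * X) - s * (s + r) * Y ≤ r * (s + r) * Q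
  weighted = subst (λ n → r * s * n - s * (s + r) * Y ≤ r * (s + r) * Q) (norm-⊗ a x)
               (norm-⊕-lowerBound r s (a ⊗ x) y)
  decomposition : ∀ r s A X Y Q → (s + r) * (r * Q - s * X)
    ≡ (r * (s + r) * Q - (r * s * (A * X) - s * (s + r) * Y)) + r * s * X * (A - + 5)
      + (s + r) * (r * X - s * Y) + X * (+ 3 * (r * s) - (r * r + s * s))
  decomposition = solve-∀

hermitian : ℤ → 𝔾 → ℤ → 𝔾 → 𝔾 → ℤ
hermitian α g δ x y = α * norm x + + 2 * re (g ⊗ x ⊗ conj y) + δ * norm y

-- Completing the square: α · hermitian α g δ x y = |α x + ḡ y|² + (α δ - |g|²) |y|².
hermitian-nonneg : ∀ {α g δ} x y → 0ℤ < α → norm g ≤ α * δ → 0ℤ ≤ hermitian α g δ x y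
hermitian-nonneg {α} {g} {δ} x y 0<α g≤αδ =
  *-nonneg-cancelˡ α 0<α (subst (0ℤ ≤_) (sym (components α δ (re g) (im g) (re x) (im x) (re y) (im y)))
    (ℤP.+-mono-≤ (norm-nonneg (α · x ⊕ conj g ⊗ y)) (*-nonneg (ℤP.i≤j⇒0≤j-i g≤αδ) (norm-nonneg y))))
  where
  components : ∀ α δ g₁ g₂ x₁ x₂ y₁ y₂ →
    α * (α * (x₁ * x₁ + x₂ * x₂) + + 2 * ((g₁ * x₁ - g₂ * x₂) * y₁ - (g₁ * x₂ + g₂ * x₁) * (- y₂))
         + δ * (y₁ * y₁ + y₂ * y₂))
    ≡ (α * x₁ + (g₁ * y₁ - (- g₂) * y₂)) * (α * x₁ + (g₁ * y₁ - (- g₂) * y₂))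
      + (α * x₂ + (g₁ * y₂ + (- g₂) * y₁)) * (α * x₂ + (g₁ * y₂ + (- g₂) * y₁))
      + (α * δ - (g₁ * g₁ + g₂ * g₂)) * (y₁ * y₁ + y₂ * y₂)
  components = solve-∀

norm-⊗⊕⊗ : ∀ u v x y → norm (u ⊗ x ⊕ v ⊗ y) ≡ hermitian (norm u) (u ⊗ conj v) (norm v) x y
norm-⊗⊕⊗ u v x y = components (re u) (im u) (re v) (im v) (re x) (im x) (re y) (im y)
  where
  components : ∀ u₁ u₂ v₁ v₂ x₁ x₂ y₁ y₂ →
    ((u₁ * x₁ - u₂ * x₂) + (v₁ * y₁ - v₂ * y₂)) * ((u₁ * x₁ - u₂ * x₂) + (v₁ * y₁ - v₂ * y₂))
      + ((u₁ * x₂ + u₂ * x₁) + (v₁ * y₂ + v₂ * y₁)) * ((u₁ * x₂ + u₂ * x₁) + (v₁ * y₂ + v₂ * y₁))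
    ≡ (u₁ * u₁ + u₂ * u₂) * (x₁ * x₁ + x₂ * x₂)
      + + 2 * (((u₁ * v₁ - u₂ * (- v₂)) * x₁ - (u₁ * (- v₂) + u₂ * v₁) * x₂) * y₁
               - ((u₁ * v₁ - u₂ * (- v₂)) * x₂ + (u₁ * (- v₂) + u₂ * v₁) * x₁) * (- y₂))
      + (v₁ * v₁ + v₂ * v₂) * (y₁ * y₁ + y₂ * y₂)
  components = solve-∀

norm-⊗⊕ : ∀ u x y → norm (u ⊗ x ⊕ y) ≡ hermitian (norm u) u (+ 1) x y
norm-⊗⊕ u x y = components (re u) (im u) (re x) (im x) (re y) (im y)
  where
  components : ∀ u₁ u₂ x₁ x₂ y₁ y₂ →
    ((u₁ * x₁ - u₂ * x₂) + y₁) * ((u₁ * x₁ - u₂ * x₂) + y₁)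
      + ((u₁ * x₂ + u₂ * x₁) + y₂) * ((u₁ * x₂ + u₂ * x₁) + y₂)
    ≡ (u₁ * u₁ + u₂ * u₂) * (x₁ * x₁ + x₂ * x₂)
      + + 2 * ((u₁ * x₁ - u₂ * x₂) * y₁ - (u₁ * x₂ + u₂ * x₁) * (- y₂))
      + + 1 * (y₁ * y₁ + y₂ * y₂)
  components = solve-∀

⊗⊕-twice : ∀ a b x y → b ⊗ (a ⊗ x ⊕ y) ⊕ x ≡ (a ⊗ b ⊕ 1𝔾) ⊗ x ⊕ b ⊗ y
⊗⊕-twice a b x y = cong₂ _+i_ (real (re a) (im a) (re b) (im b) (re x) (im x) (re y) (im y))
                               (imaginary (re a) (im a) (re b) (im b) (re x) (im x) (re y) (im y))
  where
  real : ∀ a₁ a₂ b₁ b₂ x₁ x₂ y₁ y₂ →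
    b₁ * ((a₁ * x₁ - a₂ * x₂) + y₁) - b₂ * ((a₁ * x₂ + a₂ * x₁) + y₂) + x₁
    ≡ ((a₁ * b₁ - a₂ * b₂ + + 1) * x₁ - (a₁ * b₂ + a₂ * b₁ + + 0) * x₂) + (b₁ * y₁ - b₂ * y₂)
  real = solve-∀
  imaginary : ∀ a₁ a₂ b₁ b₂ x₁ x₂ y₁ y₂ →
    b₁ * ((a₁ * x₂ + a₂ * x₁) + y₂) + b₂ * ((a₁ * x₁ - a₂ * x₂) + y₁) + x₂
    ≡ ((a₁ * b₁ - a₂ * b₂ + + 1) * x₂ + (a₁ * b₂ + a₂ * b₁ + + 0) * x₁) + (b₁ * y₂ + b₂ * y₁)
  imaginary = solve-∀

-- 131/50 lies just above φ²; the slack 60(|x|² - 2|y|²) > 0 turns semidefiniteness into strict growth.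
certificate-α : 𝔾 → 𝔾 → ℤ
certificate-α a b = + 50 * norm (a ⊗ b ⊕ 1𝔾) - + 131 * norm a - + 60

certificate-γ : 𝔾 → 𝔾 → 𝔾
certificate-γ a b = (+ 50) · ((a ⊗ b ⊕ 1𝔾) ⊗ conj b) ⊕ (- + 131) · a

certificate-δ : 𝔾 → ℤ
certificate-δ b = + 50 * norm b - + 11

certificate-identity : ∀ a b x y →
  + 50 * norm (b ⊗ (a ⊗ x ⊕ y) ⊕ x) - + 131 * norm (a ⊗ x ⊕ y)
  ≡ hermitian (certificate-α a b) (certificate-γ a b) (certificate-δ b) x y + + 60 * (norm x - + 2 * norm y)
certificate-identity a b x y = begin
  + 50 * norm (b ⊗ (a ⊗ x ⊕ y) ⊕ x) - + 131 * norm (a ⊗ x ⊕ y)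
    ≡⟨ cong₂ (λ m n → + 50 * m - + 131 * n)
             (trans (cong norm (⊗⊕-twice a b x y)) (norm-⊗⊕⊗ c b x y)) (norm-⊗⊕ a x y) ⟩
  + 50 * hermitian (norm c) (c ⊗ conj b) (norm b) x y - + 131 * hermitian (norm a) a (+ 1) x y
    ≡⟨ combination (norm c) (norm b) (norm a) (re (c ⊗ conj b)) (im (c ⊗ conj b))
                   (re a) (im a) (re x) (im x) (re y) (im y) ⟩
  hermitian (certificate-α a b) (certificate-γ a b) (certificate-δ b) x y + + 60 * (norm x - + 2 * norm y) ∎
  where
  open ≡-Reasoning
  c = a ⊗ b ⊕ 1𝔾
  combination : ∀ Nc Nb Na w₁ w₂ a₁ a₂ x₁ x₂ y₁ y₂ →
    let X = x₁ * x₁ + x₂ * x₂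
        Y = y₁ * y₁ + y₂ * y₂
        g₁ = + 50 * w₁ + (- + 131) * a₁
        g₂ = + 50 * w₂ + (- + 131) * a₂
    in + 50 * (Nc * X + + 2 * ((w₁ * x₁ - w₂ * x₂) * y₁ - (w₁ * x₂ + w₂ * x₁) * (- y₂)) + Nb * Y)
       - + 131 * (Na * X + + 2 * ((a₁ * x₁ - a₂ * x₂) * y₁ - (a₁ * x₂ + a₂ * x₁) * (- y₂)) + + 1 * Y)
       ≡ (+ 50 * Nc - + 131 * Na - + 60) * X
         + + 2 * ((g₁ * x₁ - g₂ * x₂) * y₁ - (g₁ * x₂ + g₂ * x₁) * (- y₂))
         + (+ 50 * Nb - + 11) * Y + + 60 * (X - + 2 * Y)
  combination = solve-∀

Certified : 𝔾 → 𝔾 → Set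
Certified a b = 0ℤ < certificate-α a b × norm (certificate-γ a b) ≤ certificate-α a b * certificate-δ b

growth-of-certified : ∀ a b x y → Certified a b → + 2 * norm y < norm x
  → + 131 * norm (a ⊗ x ⊕ y) < + 50 * norm (b ⊗ (a ⊗ x ⊕ y) ⊕ x)
growth-of-certified a b x y (0<α , γ≤αδ) 2y<x =
  <-byDiff _ (certificate-identity a b x y)
    (ℤP.+-mono-≤-< (hermitian-nonneg {certificate-α a b} {certificate-γ a b} x y 0<α γ≤αδ)
                   (*-pos {+ 60} (+<+ (s≤s z≤n)) (<⇒0<-diff 2y<x)))

growth-of-large-b : ∀ a b x y → + 2 ≤ norm a → + 10 ≤ norm b → + 2 * norm y < norm x
  → + 3 * norm (a ⊗ x ⊕ y) < norm (b ⊗ (a ⊗ x ⊕ y) ⊕ x)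
growth-of-large-b a b x y 2≤A 10≤B 2y<x =
  <-byScaledDiff (+ 2) _ (+<+ (s≤s z≤n)) (decomposition A B X Y Q Q′)
    (ℤP.+-mono-≤-<
      (ℤP.+-mono-≤ (ℤP.+-mono-≤ (ℤP.+-mono-≤ (ℤP.i≤j⇒0≤j-i step₂)
                                             (*-nonneg (ℤP.i≤j⇒0≤j-i 10≤B) (norm-nonneg w)))
                                (*-nonneg {+ 2} (+≤+ z≤n) (ℤP.i≤j⇒0≤j-i step₁)))
                   (*-nonneg (*-nonneg {+ 2} (+≤+ z≤n) (ℤP.i≤j⇒0≤j-i 2≤A)) (norm-nonneg x)))
      (*-pos {+ 2} (+<+ (s≤s z≤n)) (<⇒0<-diff 2y<x)))
  where
  A = norm a
  B = norm b
  X = norm x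
  Y = norm y
  w = a ⊗ x ⊕ y
  Q = norm w
  Q′ = norm (b ⊗ w ⊕ x)
  step₁ : A * X ≤ + 2 * Q + + 2 * Y
  step₁ = subst (_≤ + 2 * Q + + 2 * Y) (norm-⊗ a x) (norm-⊕-parallelogram (a ⊗ x) y)
  step₂ : B * Q ≤ + 2 * Q′ + + 2 * X
  step₂ = subst (_≤ + 2 * Q′ + + 2 * X) (norm-⊗ b w) (norm-⊕-parallelogram (b ⊗ w) x)
  decomposition : ∀ A B X Y Q Q′ → + 2 * (Q′ - + 3 * Q)
    ≡ (+ 2 * Q′ + + 2 * X - B * Q) + (B - + 10) * Q + + 2 * (+ 2 * Q + + 2 * Y - A * X)
      + + 2 * (A - + 2) * X + + 2 * (X - + 2 * Y)
  decomposition = solve-∀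

m*m≤n*n⇒m≤n : ∀ {m n} → m ℕ.* m ℕ.≤ n ℕ.* n → m ℕ.≤ n
m*m≤n*n⇒m≤n {m} {n} m²≤n² with m ℕ.≤? n
... | yes m≤n = m≤n
... | no m≰n = contradiction m²≤n² (ℕP.<⇒≱ (ℕP.*-mono-< (ℕP.≰⇒> m≰n) (ℕP.≰⇒> m≰n)))

i*i≤k*k⇒∣i∣≤k : ∀ k i → i * i ≤ + (k ℕ.* k) → ℤ.∣ i ∣ ℕ.≤ k
i*i≤k*k⇒∣i∣≤k k i i²≤k² =
  m*m≤n*n⇒m≤n (ℤP.drop‿+≤+ (subst (_≤ + (k ℕ.* k)) (sym +∣i∣²≡i*i) i²≤k²))
  where
  +∣i∣²≡i*i : + (ℤ.∣ i ∣ ℕ.* ℤ.∣ i ∣) ≡ i * i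
  +∣i∣²≡i*i = trans (cong +_ (sym (ℤP.abs-* i i))) (ℤP.0≤i⇒+∣i∣≡i (square-nonneg i))

span : ℕ → List ℤ
span zero = 0ℤ ∷ []
span (suc k) = + suc k ∷ -[1+ k ] ∷ span k

∣i∣≤k⇒∈span : ∀ k i → ℤ.∣ i ∣ ℕ.≤ k → i ∈ span k
∣i∣≤k⇒∈span zero (+ zero) _ = here refl
∣i∣≤k⇒∈span (suc k) (+ n) n≤1+k with n ℕ.≟ suc k
... | yes refl = here refl
... | no n≢1+k = there (there (∣i∣≤k⇒∈span k (+ n) (ℕ.s≤s⁻¹ (ℕP.≤∧≢⇒< n≤1+k n≢1+k))))
∣i∣≤k⇒∈span (suc k) -[1+ n ] 1+n≤1+k with n ℕ.≟ k
... | yes refl = there (here refl)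
... | no n≢k = there (there (∣i∣≤k⇒∈span k -[1+ n ] (ℕP.≤∧≢⇒< (ℕ.s≤s⁻¹ 1+n≤1+k) n≢k)))

record Boxed (k : ℕ) (P : 𝔾 → Set) : Set where
  constructor boxed
  field entries : All (λ r → All (λ i → P (r +i i)) (span k)) (span k)

boxed? : ∀ {P} → Decidable P → ∀ k → Dec (Boxed k P)
boxed? P? k = map′ boxed Boxed.entries (all? (λ r → all? (λ i → P? (r +i i)) (span k)) (span k))

Boxed⇒ : ∀ {k P} → Boxed k P → ∀ z → norm z ≤ + (k ℕ.* k) → P z
Boxed⇒ {k} (boxed box) z z≤k² =
  All.lookup (All.lookup box (coordinate∈span (re z) re²≤norm)) (coordinate∈span (im z) im²≤norm)
  where
  coordinate∈span : ∀ i → i * i ≤ norm z → i ∈ span k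
  coordinate∈span i i²≤norm = ∣i∣≤k⇒∈span k i (i*i≤k*k⇒∣i∣≤k k i (ℤP.≤-trans i²≤norm z≤k²))
  re²≤norm : re z * re z ≤ norm z
  re²≤norm = ℤP.i≤i+j (re z * re z) (im z * im z) ⦃ ℤ.nonNegative (square-nonneg (im z)) ⦄
  im²≤norm : im z * im z ≤ norm z
  im²≤norm = ℤP.i≤j+i (im z * im z) (re z * re z) ⦃ ℤ.nonNegative (square-nonneg (re z)) ⦄

SmallCase : 𝔾 → 𝔾 → Set
SmallCase a b = + 2 ≤ norm a × norm a ≤ + 4 × + 2 ≤ norm b × norm b ≤ + 9 × χ b ≤ re (a ⊗ b)

certificates : Boxed 2 (λ a → Boxed 3 (λ b → SmallCase a b → Certified a b))
certificates = from-yes (boxed? (λ a → boxed? (λ b → smallCase? a b →-dec certified? a b) 3) 2)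
  where
  smallCase? : ∀ a b → Dec (SmallCase a b)
  smallCase? a b = + 2 ℤ.≤? norm a ×-dec norm a ℤ.≤? + 4 ×-dec + 2 ℤ.≤? norm b ×-dec norm b ℤ.≤? + 9
                   ×-dec χ b ℤ.≤? re (a ⊗ b)
  certified? : ∀ a b → Dec (Certified a b)
  certified? a b = 0ℤ ℤ.<? certificate-α a b ×-dec norm (certificate-γ a b) ℤ.≤? certificate-α a b * certificate-δ b

growth-131/50 : ∀ a b x y → + 2 ≤ norm a → norm a ≤ + 4 → + 2 ≤ norm b → χ b ≤ re (a ⊗ b)
  → + 2 * norm y < norm x → + 131 * norm (a ⊗ x ⊕ y) < + 50 * norm (b ⊗ (a ⊗ x ⊕ y) ⊕ x)
growth-131/50 a b x y 2≤A A≤4 2≤B χ≤ab 2y<x = case norm b ℤ.≤? + 9 of λ where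
    (yes B≤9) → growth-of-certified a b x y
      (Boxed⇒ (Boxed⇒ certificates a A≤4) b B≤9 (2≤A , A≤4 , 2≤B , B≤9 , χ≤ab)) 2y<x
    (no B≰9) → <-byDiff _ (rearrange (norm (a ⊗ x ⊕ y)) (norm (b ⊗ (a ⊗ x ⊕ y) ⊕ x)))
      (ℤP.+-mono-<-≤
        (*-pos {+ 50} (+<+ (s≤s z≤n))
          (<⇒0<-diff (growth-of-large-b a b x y 2≤A (ℤP.i<j⇒suc[i]≤j (ℤP.≰⇒> B≰9)) 2y<x)))
        (*-nonneg {+ 19} (+≤+ z≤n) (norm-nonneg (a ⊗ x ⊕ y))))
  where
  rearrange : ∀ Q Q′ → + 50 * Q′ - + 131 * Q ≡ + 50 * (Q′ - + 3 * Q) + + 19 * Q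
  rearrange = solve-∀

growth-of-small-a : ∀ r s a b x y → 0ℤ < r → + 2 * r < s → + 50 * s ≤ + 131 * r
  → s * norm y < r * norm x → + 2 ≤ norm a → norm a ≤ + 4 → + 2 ≤ norm b → χ b ≤ re (a ⊗ b)
  → s * norm (a ⊗ x ⊕ y) < r * norm (b ⊗ (a ⊗ x ⊕ y) ⊕ x)
growth-of-small-a r s a b x y 0<r 2r<s 50s≤131r sy<rx 2≤A A≤4 2≤B χ≤ab =
  <-byScaledDiff (+ 50) _ (+<+ (s≤s z≤n)) (split r s Q Q′)
    (ℤP.+-mono-<-≤ (*-pos 0<r (<⇒0<-diff (growth-131/50 a b x y 2≤A A≤4 2≤B χ≤ab 2y<x)))
                   (*-nonneg (norm-nonneg (a ⊗ x ⊕ y)) (ℤP.i≤j⇒0≤j-i 50s≤131r)))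
  where
  X = norm x
  Y = norm y
  Q = norm (a ⊗ x ⊕ y)
  Q′ = norm (b ⊗ (a ⊗ x ⊕ y) ⊕ x)
  split : ∀ r s Q Q′ → + 50 * (r * Q′ - s * Q) ≡ r * (+ 50 * Q′ - + 131 * Q) + Q * (+ 131 * r - + 50 * s)
  split = solve-∀
  shift : ∀ r s X Y → r * (X - + 2 * Y) ≡ r * X - s * Y + (s - + 2 * r) * Y
  shift = solve-∀
  2y<x : + 2 * Y < X
  2y<x = <-byScaledDiff r _ 0<r (shift r s X Y)
    (ℤP.+-mono-<-≤ (<⇒0<-diff sy<rx) (*-nonneg (ℤP.<⇒≤ (<⇒0<-diff 2r<s)) (norm-nonneg y)))

golden-window : ∀ P Q → 0ℤ < P → 0ℤ < Q → + 2 * (Q * Q) < P * P → P * P < P * Q + Q * Q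
  → Q * Q * (Q * Q) + P * P * (P * P) ≤ + 3 * (Q * Q * (P * P))
golden-window P Q 0<P 0<Q 2r<s s<PQ+r =
  ≤-byDiff _ (difference-of-squares P Q) (*-nonneg (ℤP.<⇒≤ (<⇒0<-diff s<PQ+r)) (ℤP.<⇒≤ 0<PQ+s-r))
  where
  difference-of-squares : ∀ P Q → + 3 * (Q * Q * (P * P)) - (Q * Q * (Q * Q) + P * P * (P * P))
                                  ≡ (P * Q + Q * Q - P * P) * (P * Q + P * P - Q * Q)
  difference-of-squares = solve-∀
  rearrange : ∀ P Q → P * Q + (P * P - + 2 * (Q * Q)) + Q * Q ≡ P * Q + P * P - Q * Q
  rearrange = solve-∀
  0<PQ+s-r : 0ℤ < P * Q + P * P - Q * Q
  0<PQ+s-r = subst (0ℤ <_) (rearrange P Q)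
    (ℤP.+-mono-<-≤ (ℤP.+-mono-< (*-pos 0<P 0<Q) (<⇒0<-diff 2r<s)) (square-nonneg Q))

-- 81/50 > φ, hence 131/50 = 1 + 81/50 > 1 + φ = φ².
golden-131/50 : ∀ P Q → 0ℤ < Q → P * P < P * Q + Q * Q → + 50 * (P * P) ≤ + 131 * (Q * Q)
golden-131/50 P Q 0<Q s<PQ+r =
  ≤-byDiff _ (split P Q)
    (ℤP.+-mono-≤ (*-nonneg {+ 50} (+≤+ z≤n) (ℤP.<⇒≤ (<⇒0<-diff s<PQ+r)))
                 (*-nonneg (ℤP.<⇒≤ 0<Q) (ℤP.i≤j⇒0≤j-i 50P≤81Q)))
  where
  split : ∀ P Q → + 131 * (Q * Q) - + 50 * (P * P) ≡ + 50 * (P * Q + Q * Q - P * P) + Q * (+ 81 * Q - + 50 * P)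
  split = solve-∀
  sum-of-squares : ∀ P Q → + 2500 * (P * Q + Q * Q - P * P) + + 11 * (Q * Q)
    + + 112 * Q * (+ 50 * P - + 81 * Q) + (+ 50 * P - + 81 * Q) * (+ 50 * P - + 81 * Q) ≡ 0ℤ
  sum-of-squares = solve-∀
  50P≤81Q : + 50 * P ≤ + 81 * Q
  50P≤81Q with + 50 * P ℤ.≤? + 81 * Q
  ... | yes 50P≤81Q = 50P≤81Q
  ... | no 50P≰81Q = contradiction (subst (0ℤ <_) (sum-of-squares P Q)
        (ℤP.+-mono-<-≤ (ℤP.+-mono-<-≤ (ℤP.+-mono-<-≤ (*-pos {+ 2500} (+<+ (s≤s z≤n)) (<⇒0<-diff s<PQ+r))
                                                     (*-nonneg {+ 11} (+≤+ z≤n) (square-nonneg Q)))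
                                       (*-nonneg (*-nonneg {+ 112} (+≤+ z≤n) (ℤP.<⇒≤ 0<Q))
                                                 (ℤP.<⇒≤ (<⇒0<-diff (ℤP.≰⇒> 50P≰81Q)))))
                       (square-nonneg (+ 50 * P - + 81 * Q))))
        (ℤP.<-irrefl refl)

toℚᵘ-toℚ : ∀ n → toℚᵘ (toℚ n) ≃ mkℚᵘ (+ n) 0
toℚᵘ-toℚ n = ℚP.toℚᵘ-cong (ℚP.normalize-coprime (Coprimality.sym (Coprimality.1-coprimeTo n)))

<⇔<ᵘ : ∀ {p q e f} → toℚᵘ p ≃ e → toℚᵘ q ≃ f → p ℚ.< q ⇔ e ℚᵘ.< f
<⇔<ᵘ p≃e q≃f = mk⇔
  (λ p<q → ℚᵘP.<-respʳ-≃ q≃f (ℚᵘP.<-respˡ-≃ p≃e (ℚP.toℚᵘ-mono-< p<q)))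
  (λ e<f → ℚP.toℚᵘ-cancel-<
             (ℚᵘP.<-respʳ-≃ (ℚᵘP.≃-sym q≃f) (ℚᵘP.<-respˡ-≃ (ℚᵘP.≃-sym p≃e) e<f)))

module _ (P : ℤ) (d : ℕ) .(c : Coprime ℤ.∣ P ∣ (suc d)) where
  private
    σ = mkℚ P d c
    Q = + suc d

  AbsGt⇔ : ∀ u v → AbsGt σ u v ⇔ P * P * norm v < Q * Q * norm u
  AbsGt⇔ u v = mk⇔ (λ h → subst₂ _<_ lhs rhs (ℚᵘP.drop-*<* (Equivalence.to unnormalised h)))
                   (λ h → Equivalence.from unnormalised (*<* (subst₂ _<_ (sym lhs) (sym rhs) h)))
    where
    unnormalised = <⇔<ᵘ (ℚᵘP.≃-trans (ℚP.toℚᵘ-homo-* (σ ℚ.* σ) (toℚ ∣ v ∣²))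
                                     (ℚᵘP.*-cong (ℚP.toℚᵘ-homo-* σ σ) (toℚᵘ-toℚ ∣ v ∣²)))
                        (toℚᵘ-toℚ ∣ u ∣²)
    lhs : P * P * + ∣ v ∣² * + 1 ≡ P * P * norm v
    lhs = trans (ℤP.*-identityʳ _) (cong (P * P *_) (∣∣²≡norm v))
    rhs : + ∣ u ∣² * (Q * Q * + 1) ≡ Q * Q * norm u
    rhs = trans (cong₂ _*_ (∣∣²≡norm u) (ℤP.*-identityʳ (Q * Q))) (ℤP.*-comm (norm u) (Q * Q))

  0<σ⇒0<P : 0ℚ ℚ.< σ → 0ℤ < P
  0<σ⇒0<P (ℚ.*<* h) = subst₂ _<_ (ℤP.*-zeroˡ Q) (ℤP.*-identityʳ P) h

  2<σ²⇒2Q²<P² : toℚ 2 ℚ.< σ ℚ.* σ → + 2 * (Q * Q) < P * P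
  2<σ²⇒2Q²<P² h = subst (+ 2 * (Q * Q) <_) (ℤP.*-identityʳ (P * P))
    (ℚᵘP.drop-*<* (Equivalence.to (<⇔<ᵘ (toℚᵘ-toℚ 2) (ℚP.toℚᵘ-homo-* σ σ)) h))

  σ²<σ+1⇒P²<PQ+Q² : σ ℚ.* σ ℚ.< σ ℚ.+ 1ℚ → P * P < P * Q + Q * Q
  σ²<σ+1⇒P²<PQ+Q² h = <-byScaledDiff Q _ (+<+ (s≤s z≤n)) (sym (clear P Q))
    (<⇒0<-diff (ℚᵘP.drop-*<* (Equivalence.to (<⇔<ᵘ (ℚP.toℚᵘ-homo-* σ σ) (ℚP.toℚᵘ-homo-+ σ 1ℚ)) h)))
    where
    clear : ∀ P Q → (P * + 1 + + 1 * Q) * (Q * Q) - P * P * (Q * + 1) ≡ Q * (P * Q + Q * Q - P * P)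
    clear = solve-∀

module _ {P : ℤ} {d : ℕ} .{c : Coprime ℤ.∣ P ∣ (suc d)}
         (0<σ : 0ℚ ℚ.< mkℚ P d c) (2<σ² : toℚ 2 ℚ.< mkℚ P d c ℚ.* mkℚ P d c)
         (σ²<σ+1 : mkℚ P d c ℚ.* mkℚ P d c ℚ.< mkℚ P d c ℚ.+ 1ℚ) where
  private
    σ = mkℚ P d c
    Q = + suc d
    r = Q * Q
    s = P * P
    0<P : 0ℤ < P
    0<P = 0<σ⇒0<P P d c 0<σ
    0<Q : 0ℤ < Q
    0<Q = +<+ (s≤s z≤n)
    2r<s : + 2 * r < s
    2r<s = 2<σ²⇒2Q²<P² P d c 2<σ²
    P²<PQ+Q² : P * P < P * Q + Q * Q
    P²<PQ+Q² = σ²<σ+1⇒P²<PQ+Q² P d c σ²<σ+1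
    open Equivalence using (to; from)

  AbsGt-large-a : ∀ a x y → AbsGt σ x y → + 5 ≤ norm a → AbsGt σ (a ⊗ x ⊕ y) x
  AbsGt-large-a a x y x>σy 5≤A = from (AbsGt⇔ P d c (a ⊗ x ⊕ y) x)
    (growth-of-large-a r s a x y (*-pos 0<Q 0<Q) (*-pos 0<P 0<P) (golden-window P Q 0<P 0<Q 2r<s P²<PQ+Q²)
      (to (AbsGt⇔ P d c x y) x>σy) 5≤A)

  AbsGt-small-a : ∀ a b x y → AbsGt σ x y → + 2 ≤ norm a → norm a ≤ + 4 → + 2 ≤ norm b → χ b ≤ re (a ⊗ b)
    → AbsGt σ (b ⊗ (a ⊗ x ⊕ y) ⊕ x) (a ⊗ x ⊕ y)
  AbsGt-small-a a b x y x>σy 2≤A A≤4 2≤B χ≤ab = from (AbsGt⇔ P d c (b ⊗ (a ⊗ x ⊕ y) ⊕ x) (a ⊗ x ⊕ y))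
    (growth-of-small-a r s a b x y (*-pos 0<Q 0<Q) 2r<s (golden-131/50 P Q 0<Q P²<PQ+Q²)
      (to (AbsGt⇔ P d c x y) x>σy) 2≤A A≤4 2≤B χ≤ab)

proposition5p1 : (m : ℕ) (a : ℕ → 𝔾)
    → (∀ n → 1 ℕ.≤ n → n ℕ.≤ m → 1 ℕ.< ∣ a n ∣²)
    → (∀ n → n ℕ.≤ m → q a n ≢ 0𝔾)
    → (σ : ℚ) → 0ℚ ℚ.< σ → toℚ 2 ℚ.< σ ℚ.* σ → σ ℚ.* σ ℚ.< σ ℚ.+ 1ℚ
    → (n : ℕ) → 1 ℕ.≤ n → n ℕ.≤ m ∸ 1
    → AbsGt σ (Qq a n) (Qq a (n ∸ 1))
    → (4 ℕ.< ∣ a n ∣² → AbsGt σ (q a n) (Qq a n))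
    × (∣ a n ∣² ℕ.≤ 4 → χ (a (suc n)) ℤ.≤ Re (a n ⊗ a (suc n))
    → AbsGt σ (q a (suc n)) (q a n))
proposition5p1 zero _ _ _ _ _ _ _ _ (s≤s z≤n) ()
proposition5p1 (suc m) a 1<∣a∣² _ (mkℚ P d c) 0<σ 2<σ² σ²<σ+1 (suc k) (s≤s z≤n) n≤m hyp =
    (λ 4<∣aₙ∣² → AbsGt-large-a 0<σ 2<σ² σ²<σ+1 aₙ x y hyp (≤norm aₙ 4<∣aₙ∣²))
  , (λ ∣aₙ∣²≤4 χ≤aₙaₙ₊₁ → AbsGt-small-a 0<σ 2<σ² σ²<σ+1 aₙ aₙ₊₁ x y hyp
                             2≤aₙ (norm≤ aₙ ∣aₙ∣²≤4) 2≤aₙ₊₁ χ≤aₙaₙ₊₁)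
  where
  x = Qq a (suc k)
  y = Qq a k
  aₙ = a (suc k)
  aₙ₊₁ = a (suc (suc k))
  2≤aₙ : + 2 ≤ norm aₙ
  2≤aₙ = ≤norm aₙ (1<∣a∣² (suc k) (s≤s z≤n) (ℕP.m≤n⇒m≤1+n n≤m))
  2≤aₙ₊₁ : + 2 ≤ norm aₙ₊₁
  2≤aₙ₊₁ = ≤norm aₙ₊₁ (1<∣a∣² (suc (suc k)) (s≤s z≤n) (s≤s n≤m))
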